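{- For all $A,B\in\mathcal{L}_0$: $A\mathrel{|\!\sim_{{\sf pNNIL}({\sf par})}}B$ if and only if $A\mathrel{|\!\sim_{{\sf NNIL}({\sf par})}}B$.
   Context: $\mathcal{L}_0$ is the propositional language with $\wedge,\vee,\to,\bot$ over a finite set of atoms ${\sf atom}={\sf var}\cup{\sf par}$ (disjoint variables and parameters); $\vdash$ is ${\sf IPC}$-derivability. A substitution commutes with the connectives, fixes $\bot$ and fixes every parameter. ${\sf NNIL}$ is the least class containing atoms, $\bot,\top$, closed under $\wedge,\vee$, and containing $B\to C$ whenever $C\in{\sf NNIL}$ and $B$ is built from atoms, $\bot,\top$ by $\wedge,\vee$ only; ${\sf NNIL}({\sf par})$ is the set of ${\sf NNIL}$ formulas all of whose atoms are parameters; ${\sf pNNIL}({\sf par})$ is the set of those $E\in{\sf NNIL}({\sf par})$ that are ${\sf IPC}$-prime ($\vdash E\to(B\vee C)$ implies $\vdash E\to B$ or $\vdash E\to C$). For a set $\Gamma$, $A\mathrel{|\!\sim_\Gamma}B$ iff for every substitution $\theta$ and every $C\in\Gamma$, $\vdash\theta(C\to A)$ implies $\vdash\theta(C\to B)$. -}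

module Defs where

open import Data.Nat using (ℕ)
open import Data.Fin using (Fin)
open import Data.Product using (_×_)
open import Data.Sum using (_⊎_)

data Atom (m n : ℕ) : Set where
  var : Fin m → Atom m n
  par : Fin n → Atom m n

data Fm (m n : ℕ) : Set where
  at   : Atom m n → Fm m n
  ⊥'   : Fm m n
  _∧'_ : Fm m n → Fm m n → Fm m n
  _∨'_ : Fm m n → Fm m n → Fm m n
  _⇒_  : Fm m n → Fm m n → Fm m n

infixr 6 _∧'_
infixr 5 _∨'_
infixr 4 _⇒_

⊤' : ∀ {m n} → Fm m n
⊤' = ⊥' ⇒ ⊥'

data ⊢_ {m n : ℕ} : Fm m n → Set where
  ax-K   : ∀ A B → ⊢ (A ⇒ B ⇒ A)
  ax-S   : ∀ A B C → ⊢ ((A ⇒ B ⇒ C) ⇒ (A ⇒ B) ⇒ A ⇒ C)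
  ax-∧I  : ∀ A B → ⊢ (A ⇒ B ⇒ A ∧' B)
  ax-∧E₁ : ∀ A B → ⊢ (A ∧' B ⇒ A)
  ax-∧E₂ : ∀ A B → ⊢ (A ∧' B ⇒ B)
  ax-∨I₁ : ∀ A B → ⊢ (A ⇒ A ∨' B)
  ax-∨I₂ : ∀ A B → ⊢ (B ⇒ A ∨' B)
  ax-∨E  : ∀ A B C → ⊢ ((A ⇒ C) ⇒ (B ⇒ C) ⇒ A ∨' B ⇒ C)
  ax-⊥E  : ∀ A → ⊢ (⊥' ⇒ A)
  mp     : ∀ {A B} → ⊢ (A ⇒ B) → ⊢ A → ⊢ B

infix 2 ⊢_

Subst : ℕ → ℕ → Set
Subst m n = Fin m → Fm m n

subst : ∀ {m n} → Subst m n → Fm m n → Fm m n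
subst θ (at (var x)) = θ x
subst θ (at (par p)) = at (par p)
subst θ ⊥'           = ⊥'
subst θ (A ∧' B)     = subst θ A ∧' subst θ B
subst θ (A ∨' B)     = subst θ A ∨' subst θ B
subst θ (A ⇒ B)      = subst θ A ⇒ subst θ B

data ImpFree {m n : ℕ} : Fm m n → Set where
  if-at : ∀ a → ImpFree (at a)
  if-⊥  : ImpFree ⊥'
  if-⊤  : ImpFree ⊤'
  if-∧  : ∀ {A B} → ImpFree A → ImpFree B → ImpFree (A ∧' B)
  if-∨  : ∀ {A B} → ImpFree A → ImpFree B → ImpFree (A ∨' B)

data NNIL {m n : ℕ} : Fm m n → Set where
  nn-at : ∀ a → NNIL (at a)
  nn-⊥  : NNIL ⊥'
  nn-⊤  : NNIL ⊤'
  nn-∧  : ∀ {A B} → NNIL A → NNIL B → NNIL (A ∧' B)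
  nn-∨  : ∀ {A B} → NNIL A → NNIL B → NNIL (A ∨' B)
  nn-⇒  : ∀ {B C} → ImpFree B → NNIL C → NNIL (B ⇒ C)

data ParOnly {m n : ℕ} : Fm m n → Set where
  po-par : ∀ p → ParOnly (at (par p))
  po-⊥   : ParOnly ⊥'
  po-∧   : ∀ {A B} → ParOnly A → ParOnly B → ParOnly (A ∧' B)
  po-∨   : ∀ {A B} → ParOnly A → ParOnly B → ParOnly (A ∨' B)
  po-⇒   : ∀ {A B} → ParOnly A → ParOnly B → ParOnly (A ⇒ B)

NNILpar : ∀ {m n} → Fm m n → Set
NNILpar E = NNIL E × ParOnly E

Prime : ∀ {m n} → Fm m n → Set
Prime E = ∀ B C → (⊢ E ⇒ B ∨' C) → (⊢ E ⇒ B) ⊎ (⊢ E ⇒ C)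

pNNILpar : ∀ {m n} → Fm m n → Set
pNNILpar E = NNILpar E × Prime E

_∣~[_]_ : ∀ {m n} → Fm m n → (Fm m n → Set) → Fm m n → Set
_∣~[_]_ {m} {n} A Γ B =
  ∀ (θ : Subst m n) (C : Fm m n) → Γ C →
    (⊢ subst θ (C ⇒ A)) → (⊢ subst θ (C ⇒ B))

-- Every NNIL(par) formula C is IPC-equivalent to a finite disjunction of
-- prime NNIL(par) formulas E each implying C.  To find them, split a list of
-- NNIL conjuncts at ⊥, ∧, ∨ and at implications whose implication-free premise
-- is derivable, until every conjunct is an atom or an implication whose premise
-- fails in the valuation making exactly the atoms of the list true.  Such a
-- conjunction is prime by an Aczel-slash argument: that valuation shows the
-- slash never reaches the premise of a remaining implication.  As derivability
-- is closed under substitution, ⊢ θ(C → A) yields ⊢ θ(E → A) for each E, hence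
-- ⊢ θ(E → B), hence ⊢ θ(C → B).
module Submission where

open import Defs
open import Data.Nat using (ℕ; suc; _+_; _<_; s≤s)
open import Data.Nat.Properties using (+-assoc; ≤-trans; ≤-reflexive; m≤m+n; m≤n+m; +-monoˡ-≤)
open import Data.Nat.Induction using (<-wellFounded)
open import Data.Nat.ListAction using (sum)
open import Data.Nat.ListAction.Properties using (sum-↭)
open import Data.Fin using () renaming (_≟_ to _≟ᶠ_)
open import Data.Empty using (⊥; ⊥-elim)
open import Data.Product using (_×_; _,_; proj₁; proj₂; ∃₂)
open import Data.Sum using (_⊎_; inj₁; inj₂; [_,_])
open import Data.List using (List; []; _∷_; _++_; map)
open import Data.List.Relation.Unary.Any using (Any; here; there; any?)
open import Data.List.Relation.Unary.All using (All; []; _∷_)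
import Data.List.Relation.Unary.All as All
open import Data.List.Membership.Propositional using (_∈_; find)
open import Data.List.Membership.Propositional.Properties using (∈-map⁻; ∈-++⁺ˡ; ∈-++⁺ʳ; ∈-++⁻; ∈-∃++)
open import Data.List.Relation.Unary.All.Properties using (++⁺)
open import Data.List.Relation.Binary.Subset.Propositional using (_⊆_)
open import Data.List.Relation.Binary.Permutation.Propositional using (_↭_; ↭-sym)
open import Data.List.Relation.Binary.Permutation.Propositional.Properties
  using (∈-resp-↭; All-resp-↭; shift; map⁺)
open import Function using (_∘_)
open import Function.Bundles using (_⇔_; mk⇔)
open import Induction.WellFounded using (Acc; acc)
open import Relation.Binary.Definitions using (DecidableEquality)
open import Relation.Binary.PropositionalEquality using (_≡_; refl; cong; sym)
import Relation.Binary.PropositionalEquality as ≡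
open import Relation.Nullary using (Dec; yes; no; ¬_)
open import Relation.Nullary.Decidable using (map′; _×-dec_; _⊎-dec_; _→-dec_)

private
  variable
    m n : ℕ
    A B C C′ D E G X Y Z : Fm m n
    Γ Δ Es Fs : List (Fm m n)

⇒-const : ⊢ X → ⊢ A ⇒ X
⇒-const x = mp (ax-K _ _) x

⇒-app : ⊢ A ⇒ X ⇒ Y → ⊢ A ⇒ X → ⊢ A ⇒ Y
⇒-app f x = mp (mp (ax-S _ _ _) f) x

⇒-refl : ⊢ A ⇒ A
⇒-refl {A = A} = ⇒-app (ax-K A (A ⇒ A)) (ax-K A A)

⇒-trans : ⊢ A ⇒ B → ⊢ B ⇒ C → ⊢ A ⇒ C
⇒-trans f g = ⇒-app (⇒-const g) f

∧-intro : ⊢ A ⇒ X → ⊢ A ⇒ Y → ⊢ A ⇒ X ∧' Y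
∧-intro f g = ⇒-app (⇒-app (⇒-const (ax-∧I _ _)) f) g

∧-elimˡ : ⊢ A ⇒ X ∧' Y → ⊢ A ⇒ X
∧-elimˡ f = ⇒-trans f (ax-∧E₁ _ _)

∧-elimʳ : ⊢ A ⇒ X ∧' Y → ⊢ A ⇒ Y
∧-elimʳ f = ⇒-trans f (ax-∧E₂ _ _)

∨-introˡ : ⊢ A ⇒ X → ⊢ A ⇒ X ∨' Y
∨-introˡ f = ⇒-trans f (ax-∨I₁ _ _)

∨-introʳ : ⊢ A ⇒ Y → ⊢ A ⇒ X ∨' Y
∨-introʳ f = ⇒-trans f (ax-∨I₂ _ _)

∨-elim : ⊢ A ⇒ X ⇒ Z → ⊢ A ⇒ Y ⇒ Z → ⊢ A ⇒ X ∨' Y → ⊢ A ⇒ Z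
∨-elim f g d = ⇒-app (⇒-app (⇒-app (⇒-const (ax-∨E _ _ _)) f) g) d

⇒-curry : ⊢ A ∧' X ⇒ Z → ⊢ A ⇒ X ⇒ Z
⇒-curry {A = A} {X = X} h =
  ⇒-app (⇒-app (⇒-const (ax-S X (A ∧' X) _)) (⇒-const (⇒-const h))) (ax-∧I A X)

∧-assoc : ⊢ (A ∧' B) ∧' C ⇒ A ∧' (B ∧' C)
∧-assoc = ∧-intro (∧-elimˡ (ax-∧E₁ _ _))
                  (∧-intro (∧-elimʳ (ax-∧E₁ _ _)) (ax-∧E₂ _ _))

∧-assoc⁻¹ : ⊢ A ∧' (B ∧' C) ⇒ (A ∧' B) ∧' C
∧-assoc⁻¹ = ∧-intro (∧-intro (ax-∧E₁ _ _) (∧-elimˡ (ax-∧E₂ _ _)))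
                    (∧-elimʳ (ax-∧E₂ _ _))

∧-distribʳ-∨ : ⊢ (A ∨' B) ∧' C ⇒ (A ∧' C) ∨' (B ∧' C)
∧-distribʳ-∨ = ∨-elim (⇒-curry (∨-introˡ (∧-intro (ax-∧E₂ _ _) (∧-elimʳ (ax-∧E₁ _ _)))))
                      (⇒-curry (∨-introʳ (∧-intro (ax-∧E₂ _ _) (∧-elimʳ (ax-∧E₁ _ _)))))
                      (ax-∧E₁ _ _)

∧-distribʳ-∨⁻¹ : ⊢ (A ∧' C) ∨' (B ∧' C) ⇒ (A ∨' B) ∧' C
∧-distribʳ-∨⁻¹ = mp (mp (ax-∨E _ _ _)
                        (∧-intro (∨-introˡ (ax-∧E₁ _ _)) (ax-∧E₂ _ _)))
                    (∧-intro (∨-introʳ (ax-∧E₁ _ _)) (ax-∧E₂ _ _))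

⊢-subst : (θ : Subst m n) → ⊢ X → ⊢ subst θ X
⊢-subst θ (ax-K _ _)     = ax-K _ _
⊢-subst θ (ax-S _ _ _)   = ax-S _ _ _
⊢-subst θ (ax-∧I _ _)    = ax-∧I _ _
⊢-subst θ (ax-∧E₁ _ _)   = ax-∧E₁ _ _
⊢-subst θ (ax-∧E₂ _ _)   = ax-∧E₂ _ _
⊢-subst θ (ax-∨I₁ _ _)   = ax-∨I₁ _ _
⊢-subst θ (ax-∨I₂ _ _)   = ax-∨I₂ _ _
⊢-subst θ (ax-∨E _ _ _)  = ax-∨E _ _ _
⊢-subst θ (ax-⊥E _)      = ax-⊥E _
⊢-subst θ (mp f x)       = mp (⊢-subst θ f) (⊢-subst θ x)

⋀ : List (Fm m n) → Fm m n
⋀ []      = ⊤'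
⋀ (X ∷ Γ) = X ∧' ⋀ Γ

⋁ : List (Fm m n) → Fm m n
⋁ []      = ⊥'
⋁ (X ∷ Γ) = X ∨' ⋁ Γ

⋀-proj : X ∈ Γ → ⊢ ⋀ Γ ⇒ X
⋀-proj (here refl) = ax-∧E₁ _ _
⋀-proj (there p)   = ⇒-trans (ax-∧E₂ _ _) (⋀-proj p)

⋀-intro : (∀ {Y} → Y ∈ Δ → ⊢ A ⇒ Y) → ⊢ A ⇒ ⋀ Δ
⋀-intro {Δ = []}    h = ⇒-const ⇒-refl
⋀-intro {Δ = X ∷ Δ} h = ∧-intro (h (here refl)) (⋀-intro (h ∘ there))

⋀-⊆ : Δ ⊆ Γ → ⊢ ⋀ Γ ⇒ ⋀ Δ
⋀-⊆ Δ⊆Γ = ⋀-intro (⋀-proj ∘ Δ⊆Γ)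

⋀-↭ : Γ ↭ Δ → ⊢ ⋀ Γ ⇒ ⋀ Δ
⋀-↭ Γ↭Δ = ⋀-⊆ (∈-resp-↭ (↭-sym Γ↭Δ))

⋁-intro : E ∈ Es → ⊢ E ⇒ ⋁ Es
⋁-intro (here refl) = ax-∨I₁ _ _
⋁-intro (there p)   = ⇒-trans (⋁-intro p) (ax-∨I₂ _ _)

⋁-elim : (∀ {E} → E ∈ Es → ⊢ E ⇒ Z) → ⊢ ⋁ Es ⇒ Z
⋁-elim {Es = []}     h = ax-⊥E _
⋁-elim {Es = E ∷ Es} h = mp (mp (ax-∨E _ _ _) (h (here refl))) (⋁-elim (h ∘ there))

⋁-⊆ : Es ⊆ Fs → ⊢ ⋁ Es ⇒ ⋁ Fs
⋁-⊆ Es⊆Fs = ⋁-elim (⋁-intro ∘ Es⊆Fs)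

subst-⋁ : (θ : Subst m n) (Es : List (Fm m n)) → subst θ (⋁ Es) ≡ ⋁ (map (subst θ) Es)
subst-⋁ θ []       = refl
subst-⋁ θ (E ∷ Es) = cong (subst θ E ∨'_) (subst-⋁ θ Es)

-- The Aczel slash relative to a formula E

Slash : Fm m n → Fm m n → Set
Slash E (at a)   = ⊢ E ⇒ at a
Slash E ⊥'       = ⊢ E ⇒ ⊥'
Slash E (X ∧' Y) = Slash E X × Slash E Y
Slash E (X ∨' Y) = Slash E X ⊎ Slash E Y
Slash E (X ⇒ Y)  = (⊢ E ⇒ X ⇒ Y) × (Slash E X → Slash E Y)

slash⇒⊢ : ∀ X → Slash E X → ⊢ E ⇒ X
slash⇒⊢ (at a)   s        = s
slash⇒⊢ ⊥'       s        = s
slash⇒⊢ (X ∧' Y) (s , t)  = ∧-intro (slash⇒⊢ X s) (slash⇒⊢ Y t)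
slash⇒⊢ (X ∨' Y) (inj₁ s) = ∨-introˡ (slash⇒⊢ X s)
slash⇒⊢ (X ∨' Y) (inj₂ t) = ∨-introʳ (slash⇒⊢ Y t)
slash⇒⊢ (X ⇒ Y)  (d , _)  = d

⊥⇒slash : ∀ X → ⊢ E ⇒ ⊥' → Slash E X
⊥⇒slash (at a)   h = ⇒-trans h (ax-⊥E _)
⊥⇒slash ⊥'       h = h
⊥⇒slash (X ∧' Y) h = ⊥⇒slash X h , ⊥⇒slash Y h
⊥⇒slash (X ∨' Y) h = inj₁ (⊥⇒slash X h)
⊥⇒slash (X ⇒ Y)  h = ⇒-trans h (ax-⊥E _) , λ _ → ⊥⇒slash Y h

⊢⇒slash : ⊢ X → Slash E X
⊢⇒slash (ax-K A B) = ⇒-const (ax-K A B) , λ a →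
  ⇒-app (⇒-const (ax-K A B)) (slash⇒⊢ A a) , λ _ → a
⊢⇒slash (ax-S A B C) = ⇒-const (ax-S A B C) , λ f →
  ⇒-app (⇒-const (ax-S A B C)) (slash⇒⊢ (A ⇒ B ⇒ C) f) , λ g →
  ⇒-app (⇒-app (⇒-const (ax-S A B C)) (slash⇒⊢ (A ⇒ B ⇒ C) f)) (slash⇒⊢ (A ⇒ B) g) , λ a →
  proj₂ (proj₂ f a) (proj₂ g a)
⊢⇒slash (ax-∧I A B) = ⇒-const (ax-∧I A B) , λ a →
  ⇒-app (⇒-const (ax-∧I A B)) (slash⇒⊢ A a) , λ b → a , b
⊢⇒slash (ax-∧E₁ A B) = ⇒-const (ax-∧E₁ A B) , proj₁
⊢⇒slash (ax-∧E₂ A B) = ⇒-const (ax-∧E₂ A B) , proj₂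
⊢⇒slash (ax-∨I₁ A B) = ⇒-const (ax-∨I₁ A B) , inj₁
⊢⇒slash (ax-∨I₂ A B) = ⇒-const (ax-∨I₂ A B) , inj₂
⊢⇒slash (ax-∨E A B C) = ⇒-const (ax-∨E A B C) , λ f →
  ⇒-app (⇒-const (ax-∨E A B C)) (slash⇒⊢ (A ⇒ C) f) , λ g →
  ⇒-app (⇒-app (⇒-const (ax-∨E A B C)) (slash⇒⊢ (A ⇒ C) f)) (slash⇒⊢ (B ⇒ C) g) ,
  [ proj₂ f , proj₂ g ]
⊢⇒slash (ax-⊥E A) = ⇒-const (ax-⊥E A) , ⊥⇒slash A
⊢⇒slash (mp f x) = proj₂ (⊢⇒slash f) (⊢⇒slash x)

slash-⋀ : (∀ {X} → X ∈ Δ → Slash E X) → Slash E (⋀ Δ)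
slash-⋀ {Δ = []}    h = ⇒-const ⇒-refl , λ b → b
slash-⋀ {Δ = X ∷ Δ} h = h (here refl) , slash-⋀ (h ∘ there)

self-slash⇒prime : Slash E E → Prime E
self-slash⇒prime {E = E} s B C d with proj₂ (⊢⇒slash {E = E} d) s
... | inj₁ b = inj₁ (slash⇒⊢ B b)
... | inj₂ c = inj₂ (slash⇒⊢ C c)

-- Formulas as types

Valuation : ℕ → ℕ → Set₁
Valuation m n = Atom m n → Set

⟦_⟧ : Fm m n → Valuation m n → Set
⟦ at a ⟧   V = V a
⟦ ⊥' ⟧     V = ⊥
⟦ X ∧' Y ⟧ V = ⟦ X ⟧ V × ⟦ Y ⟧ V
⟦ X ∨' Y ⟧ V = ⟦ X ⟧ V ⊎ ⟦ Y ⟧ V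
⟦ X ⇒ Y ⟧  V = ⟦ X ⟧ V → ⟦ Y ⟧ V

sound : ⊢ X → (V : Valuation m n) → ⟦ X ⟧ V
sound (ax-K _ _)    V = λ a _ → a
sound (ax-S _ _ _)  V = λ f g a → f a (g a)
sound (ax-∧I _ _)   V = _,_
sound (ax-∧E₁ _ _)  V = proj₁
sound (ax-∧E₂ _ _)  V = proj₂
sound (ax-∨I₁ _ _)  V = inj₁
sound (ax-∨I₂ _ _)  V = inj₂
sound (ax-∨E _ _ _) V = [_,_]
sound (ax-⊥E _)     V = ⊥-elim
sound (mp f x)      V = sound f V (sound x V)

⟦⟧-dec : {V : Valuation m n} → (∀ a → Dec (V a)) → ∀ X → Dec (⟦ X ⟧ V)
⟦⟧-dec V? (at a)   = V? a
⟦⟧-dec V? ⊥'       = no λ ()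
⟦⟧-dec V? (X ∧' Y) = ⟦⟧-dec V? X ×-dec ⟦⟧-dec V? Y
⟦⟧-dec V? (X ∨' Y) = ⟦⟧-dec V? X ⊎-dec ⟦⟧-dec V? Y
⟦⟧-dec V? (X ⇒ Y)  = ⟦⟧-dec V? X →-dec ⟦⟧-dec V? Y

impFree-derivable : {V : Valuation m n} → (∀ {a} → V a → ⊢ E ⇒ at a) →
                    ImpFree D → ⟦ D ⟧ V → ⊢ E ⇒ D
impFree-derivable atoms (if-at a)  v        = atoms v
impFree-derivable atoms if-⊤       _        = ⇒-const ⇒-refl
impFree-derivable atoms (if-∧ p q) (u , v)  = ∧-intro (impFree-derivable atoms p u)
                                                      (impFree-derivable atoms q v)
impFree-derivable atoms (if-∨ p q) (inj₁ u) = ∨-introˡ (impFree-derivable atoms p u)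
impFree-derivable atoms (if-∨ p q) (inj₂ v) = ∨-introʳ (impFree-derivable atoms q v)

⋀-holds : {V : Valuation m n} → (∀ {X} → X ∈ Γ → ⟦ X ⟧ V) → ⟦ ⋀ Γ ⟧ V
⋀-holds {Γ = []}    h = λ b → b
⋀-holds {Γ = X ∷ Γ} h = h (here refl) , ⋀-holds (h ∘ there)

atomsOf : List (Fm m n) → Valuation m n
atomsOf Γ a = at a ∈ Γ

atom-≟ : DecidableEquality (Atom m n)
atom-≟ (var x) (var y) = map′ (cong var) (λ { refl → refl }) (x ≟ᶠ y)
atom-≟ (var x) (par q) = no λ ()
atom-≟ (par p) (var y) = no λ ()
atom-≟ (par p) (par q) = map′ (cong par) (λ { refl → refl }) (p ≟ᶠ q)

at-≟ : ∀ a (X : Fm m n) → Dec (at a ≡ X)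
at-≟ a (at b)   = map′ (cong at) (λ { refl → refl }) (atom-≟ a b)
at-≟ a ⊥'       = no λ ()
at-≟ a (_ ∧' _) = no λ ()
at-≟ a (_ ∨' _) = no λ ()
at-≟ a (_ ⇒ _)  = no λ ()

atomsOf-dec : (Γ : List (Fm m n)) (a : Atom m n) → Dec (atomsOf Γ a)
atomsOf-dec Γ a = any? (at-≟ a) Γ

-- Normal lists of conjuncts and their primeness

data Reducible (E : Fm m n) : Fm m n → Set where
  ⊥-red : Reducible E ⊥'
  ∧-red : Reducible E (A ∧' B)
  ∨-red : Reducible E (A ∨' B)
  ⇒-red : ⊢ E ⇒ D → Reducible E (D ⇒ G)

data Irreducible (V : Valuation m n) : Fm m n → Set where
  atom    : ∀ a → Irreducible V (at a)
  blocked : ¬ ⟦ D ⟧ V → Irreducible V (D ⇒ G)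

Normal : List (Fm m n) → Set
Normal Γ = All (Irreducible (atomsOf Γ)) Γ

reducible-resp : ⊢ E ⇒ C → Reducible C X → Reducible E X
reducible-resp E⊢C ⊥-red     = ⊥-red
reducible-resp E⊢C ∧-red     = ∧-red
reducible-resp E⊢C ∨-red     = ∨-red
reducible-resp E⊢C (⇒-red d) = ⇒-red (⇒-trans E⊢C d)

classify : (Γ : List (Fm m n)) → NNIL X → Reducible (⋀ Γ) X ⊎ Irreducible (atomsOf Γ) X
classify Γ (nn-at a)   = inj₂ (atom a)
classify Γ nn-⊥        = inj₁ ⊥-red
classify Γ nn-⊤        = inj₂ (blocked λ ())
classify Γ (nn-∧ _ _)  = inj₁ ∧-red
classify Γ (nn-∨ _ _)  = inj₁ ∨-red
classify Γ (nn-⇒ {D} d _) with ⟦⟧-dec (atomsOf-dec Γ) D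
... | yes v = inj₁ (⇒-red (impFree-derivable ⋀-proj d v))
... | no ¬v = inj₂ (blocked ¬v)

any-or-all : {P Q : Fm m n → Set} → All (λ X → P X ⊎ Q X) Γ → Any P Γ ⊎ All Q Γ
any-or-all []             = inj₂ []
any-or-all (inj₁ p ∷ pqs) = inj₁ (here p)
any-or-all (inj₂ q ∷ pqs) with any-or-all pqs
... | inj₁ any = inj₁ (there any)
... | inj₂ all = inj₂ (q ∷ all)

reducible-or-normal : (Γ : List (Fm m n)) → All NNILpar Γ → Any (Reducible (⋀ Γ)) Γ ⊎ Normal Γ
reducible-or-normal Γ nnil = any-or-all (All.map (classify Γ ∘ proj₁) nnil)

normal-holds : Normal Γ → ⟦ ⋀ Γ ⟧ (atomsOf Γ)
normal-holds {Γ = Γ} normal = ⋀-holds (λ p → holds (All.lookup normal p) p)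
  where
  holds : Irreducible (atomsOf Γ) X → X ∈ Γ → ⟦ X ⟧ (atomsOf Γ)
  holds (atom a)     p = p
  holds (blocked ¬d) _ = ⊥-elim ∘ ¬d

-- A premise D of a conjunct D ⇒ G has no slash: it would make D true in atomsOf Γ.
normal-prime : Normal Γ → Prime (⋀ Γ)
normal-prime {Γ = Γ} normal = self-slash⇒prime (slash-⋀ (λ p → slash (All.lookup normal p) p))
  where
  slash : Irreducible (atomsOf Γ) X → X ∈ Γ → Slash (⋀ Γ) X
  slash (atom a)     p = ⋀-proj p
  slash (blocked ¬d) p = ⋀-proj p , λ s →
    ⊥-elim (¬d (sound (slash⇒⊢ _ s) (atomsOf Γ) (normal-holds normal)))

record Cover (P : Fm m n → Set) (C : Fm m n) : Set where
  field
    parts   : List (Fm m n)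
    parts-P : All P parts
    ⊢-parts : ⊢ C ⇒ ⋁ parts
    parts-⊢ : ∀ {E} → E ∈ parts → ⊢ E ⇒ C

open Cover

cover-self : {P : Fm m n → Set} → P C → Cover P C
cover-self c = record
  { parts = _ ∷ [] ; parts-P = c ∷ [] ; ⊢-parts = ax-∨I₁ _ _
  ; parts-⊢ = λ { (here refl) → ⇒-refl } }

cover-⊥ : {P : Fm m n → Set} → Cover P ⊥'
cover-⊥ = record { parts = [] ; parts-P = [] ; ⊢-parts = ⇒-refl ; parts-⊢ = λ () }

cover-resp-⇔ : {P : Fm m n → Set} → ⊢ C ⇒ C′ → ⊢ C′ ⇒ C → Cover P C′ → Cover P C
cover-resp-⇔ C⊢C′ C′⊢C cov = record
  { parts = parts cov ; parts-P = parts-P cov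
  ; ⊢-parts = ⇒-trans C⊢C′ (⊢-parts cov) ; parts-⊢ = λ p → ⇒-trans (parts-⊢ cov p) C′⊢C }

cover-∨ : {P : Fm m n → Set} → Cover P X → Cover P Y → Cover P (X ∨' Y)
cover-∨ cX cY = record
  { parts = parts cX ++ parts cY
  ; parts-P = ++⁺ (parts-P cX) (parts-P cY)
  ; ⊢-parts = mp (mp (ax-∨E _ _ _) (⇒-trans (⊢-parts cX) (⋁-⊆ ∈-++⁺ˡ)))
                                   (⇒-trans (⊢-parts cY) (⋁-⊆ (∈-++⁺ʳ (parts cX))))
  ; parts-⊢ = λ p → [ (λ q → ⇒-trans (parts-⊢ cX q) (ax-∨I₁ _ _))
                    , (λ q → ⇒-trans (parts-⊢ cY q) (ax-∨I₂ _ _)) ] (∈-++⁻ (parts cX) p) }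

∣~-cover : {Γ Δ : Fm m n → Set} → (∀ {C} → Γ C → Cover Δ C) →
           A ∣~[ Δ ] B → A ∣~[ Γ ] B
∣~-cover {B = B} covers H θ C γ θC⊢θA =
  ⇒-trans (⊢-subst θ (⊢-parts cov))
          (≡.subst (λ F → ⊢ F ⇒ subst θ B) (sym (subst-⋁ θ (parts cov)))
                   (⋁-elim part⊢θB))
  where
  cov = covers γ
  part⊢θB : ∀ {F} → F ∈ map (subst θ) (parts cov) → ⊢ F ⇒ subst θ B
  part⊢θB p with ∈-map⁻ (subst θ) p
  ... | E , E∈ , refl =
    H θ E (All.lookup (parts-P cov) E∈) (⇒-trans (⊢-subst θ (parts-⊢ cov E∈)) θC⊢θA)

-- Decomposing NNIL(par) formulas into prime ones

size : Fm m n → ℕ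
size (at _)   = 1
size ⊥'       = 1
size (X ∧' Y) = suc (size X + size Y)
size (X ∨' Y) = suc (size X + size Y)
size (X ⇒ Y)  = suc (size X + size Y)

weight : List (Fm m n) → ℕ
weight Γ = sum (map size Γ)

⋀-NNILpar : All NNILpar Γ → NNILpar (⋀ Γ)
⋀-NNILpar []                     = nn-⊤ , po-⇒ po-⊥ po-⊥
⋀-NNILpar ((nnX , poX) ∷ nnilΓ) =
  nn-∧ nnX (proj₁ (⋀-NNILpar nnilΓ)) , po-∧ poX (proj₂ (⋀-NNILpar nnilΓ))

NNILpar-conclusion : NNILpar (D ⇒ G) → NNILpar G
NNILpar-conclusion (nn-⊤ , po-⇒ _ poG)     = nn-⊥ , poG
NNILpar-conclusion (nn-⇒ _ nnG , po-⇒ _ poG) = nnG , poG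

any-↭-front : {P : Fm m n → Set} → Any P Γ → ∃₂ λ X Δ → Γ ↭ X ∷ Δ × P X
any-↭-front any with find any
... | X , X∈Γ , pX with ∈-∃++ X∈Γ
...   | Γ₁ , Γ₂ , refl = X , Γ₁ ++ Γ₂ , shift X Γ₁ Γ₂ , pX

Decomposable : ℕ → ℕ → ℕ → Set
Decomposable m n k = ∀ (Δ : List (Fm m n)) → All NNILpar Δ → weight Δ < k →
                     Cover pNNILpar (⋀ Δ)

reduce-front : {X : Fm m n} {Γ : List (Fm m n)} →
               Reducible (⋀ (X ∷ Γ)) X → All NNILpar (X ∷ Γ) →
               Decomposable m n (weight (X ∷ Γ)) → Cover pNNILpar (⋀ (X ∷ Γ))
reduce-front ⊥-red _ _ = cover-resp-⇔ (ax-∧E₁ _ _) (ax-⊥E _) cover-⊥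
reduce-front {X = A ∧' B} {Γ = Γ} ∧-red ((nn-∧ nnA nnB , po-∧ poA poB) ∷ nnilΓ) ih =
  cover-resp-⇔ ∧-assoc ∧-assoc⁻¹
    (ih (A ∷ B ∷ Γ) ((nnA , poA) ∷ (nnB , poB) ∷ nnilΓ)
        (s≤s (≤-reflexive (sym (+-assoc (size A) (size B) (weight Γ))))))
reduce-front {X = A ∨' B} {Γ = Γ} ∨-red ((nn-∨ nnA nnB , po-∨ poA poB) ∷ nnilΓ) ih =
  cover-resp-⇔ ∧-distribʳ-∨ ∧-distribʳ-∨⁻¹
    (cover-∨ (ih (A ∷ Γ) ((nnA , poA) ∷ nnilΓ)
                 (s≤s (+-monoˡ-≤ (weight Γ) (m≤m+n (size A) (size B)))))
             (ih (B ∷ Γ) ((nnB , poB) ∷ nnilΓ)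
                 (s≤s (+-monoˡ-≤ (weight Γ) (m≤n+m (size B) (size A))))))
reduce-front {X = D ⇒ G} {Γ = Γ} (⇒-red ⊢D) (nnX ∷ nnilΓ) ih =
  cover-resp-⇔ (∧-intro (⇒-app (ax-∧E₁ _ _) ⊢D) (ax-∧E₂ _ _))
               (∧-intro (⇒-trans (ax-∧E₁ _ _) (ax-K G D)) (ax-∧E₂ _ _))
    (ih (G ∷ Γ) (NNILpar-conclusion nnX ∷ nnilΓ)
        (s≤s (+-monoˡ-≤ (weight Γ) (m≤n+m (size G) (size D)))))

decompose : (Γ : List (Fm m n)) → All NNILpar Γ → Acc _<_ (weight Γ) →
            Cover pNNILpar (⋀ Γ)
decompose Γ nnilΓ (acc rec) =
  [ reduce ∘ any-↭-front , (λ normal → cover-self (⋀-NNILpar nnilΓ , normal-prime normal)) ]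
  (reducible-or-normal Γ nnilΓ)
  where
  reduce : (∃₂ λ X Δ → Γ ↭ X ∷ Δ × Reducible (⋀ Γ) X) → Cover pNNILpar (⋀ Γ)
  reduce (X , Δ , Γ↭ , red) =
    cover-resp-⇔ (⋀-↭ Γ↭) (⋀-↭ (↭-sym Γ↭))
      (reduce-front (reducible-resp (⋀-↭ (↭-sym Γ↭)) red) (All-resp-↭ Γ↭ nnilΓ)
         (λ Δ′ nnilΔ′ lt → decompose Δ′ nnilΔ′
            (rec (≤-trans lt (≤-reflexive (sum-↭ (map⁺ size (↭-sym Γ↭))))))))

NNILpar-cover : NNILpar C → Cover pNNILpar C
NNILpar-cover c =
  cover-resp-⇔ (∧-intro ⇒-refl (⇒-const ⇒-refl)) (ax-∧E₁ _ _)
               (decompose (_ ∷ []) (c ∷ []) (<-wellFounded _))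

corollary3p34 : ∀ (m n : ℕ) (A B : Fm m n) →
    (A ∣~[ pNNILpar ] B) ⇔ (A ∣~[ NNILpar ] B)
corollary3p34 m n A B =
  mk⇔ (∣~-cover {A = A} {B = B} NNILpar-cover)
      (∣~-cover {A = A} {B = B} (cover-self ∘ proj₁))
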